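{- Let $F(x)\in\mathbb{R}[[x]]$ be a power series satisfying the quadratic equation $$w(x)+u(x)F(x)+v(x)F(x)^2=0,$$ where $w(x),u(x),v(x)$ are polynomials with $v(0)=0$ and $u(0)\neq 0$. Then for every integer $k\geq 1$, $$F(x)^k=\frac{ -w(x)^k}{F(x)^kv(x)^k+\sum_{i=0}^{\lfloor k/2\rfloor}(-1)^{k+i+1}T(k,i)\,u(x)^{k-2i}v(x)^iw(x)^i},$$ where $T(k,i)=\frac{(k-i-1)!\cdot k}{i!\cdot (k-2i)!}$.
   Context: The conditions $v(0)=0$, $u(0)\neq 0$ guarantee that the power series $F(x)$ satisfying the equation is unique. $F(x)^k$ denotes the $k$-th power (convolution power) of $F(x)$. -}

module Defs where

open import Level using (_⊔_)
open import Algebra.Bundles using (CommutativeRing)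
open import Data.Nat as ℕ using (ℕ; zero; suc; _∸_; _!)
open import Data.Nat.Properties using (_!*_!≢0)
open import Data.Product using (Σ; ∃; _×_)
open import Relation.Nullary using (¬_)

-- T(k,i) = (k-i-1)! * k / (i! * (k-2i)!)   (exact natural-number division;
-- for 0 ≤ i ≤ ⌊k/2⌋, k ≥ 1 the quotient is an integer: T(k,i) = k/(k-i) * C(k-i,i))
T : ℕ → ℕ → ℕ
T k i = ℕ._/_ ((k ∸ i ∸ 1) ! ℕ.* k) (i ! ℕ.* (k ∸ 2 ℕ.* i) !) {{i !* (k ∸ 2 ℕ.* i) !≢0}}

IsField : ∀ {c ℓ} → CommutativeRing c ℓ → Set (c ⊔ ℓ)
IsField R = ¬ (0# ≈ 1#) × (∀ x → ¬ (x ≈ 0#) → ∃ λ y → x * y ≈ 1#)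
  where open CommutativeRing R

module PowerSeries {c ℓ} (R : CommutativeRing c ℓ) where
  open CommutativeRing R renaming (Carrier to A)

  Series : Set c
  Series = ℕ → A

  _≈ₛ_ : Series → Series → Set ℓ
  f ≈ₛ g = ∀ n → f n ≈ g n

  IsPolynomial : Series → Set ℓ
  IsPolynomial f = Σ ℕ λ N → ∀ n → N ℕ.≤ n → f n ≈ 0#

  sumTo : ℕ → (ℕ → A) → A
  sumTo zero    g = g 0
  sumTo (suc n) g = sumTo n g + g (suc n)

  0ₛ : Series
  0ₛ _ = 0#

  1ₛ : Series
  1ₛ zero    = 1#
  1ₛ (suc _) = 0#

  _+ₛ_ : Series → Series → Series
  (f +ₛ g) n = f n + g n

  -ₛ_ : Series → Series
  (-ₛ f) n = - (f n)

  _*ₛ_ : Series → Series → Series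
  (f *ₛ g) n = sumTo n (λ j → f j * g (n ∸ j))

  _^ₛ_ : Series → ℕ → Series
  f ^ₛ zero  = 1ₛ
  f ^ₛ suc k = f *ₛ (f ^ₛ k)

  _·ₛ_ : ℕ → Series → Series
  zero  ·ₛ f = 0ₛ
  suc m ·ₛ f = f +ₛ (m ·ₛ f)

  signₛ : ℕ → Series → Series
  signₛ zero    f = f
  signₛ (suc n) f = -ₛ (signₛ n f)

  sumSeries : ℕ → (ℕ → Series) → Series
  sumSeries zero    g = g 0
  sumSeries (suc n) g = sumSeries n g +ₛ g (suc n)

  denom : (F w u v : Series) → ℕ → Series
  denom F w u v k =
    ((F ^ₛ k) *ₛ (v ^ₛ k)) +ₛ
    sumSeries (k ℕ./ 2) (λ i →
      signₛ (k ℕ.+ i ℕ.+ 1)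
        (T k i ·ₛ (((u ^ₛ (k ∸ 2 ℕ.* i)) *ₛ (v ^ₛ i)) *ₛ (w ^ₛ i))))

{-# OPTIONS --safe #-}
module Submission where

open import Defs
open import Algebra.Bundles using (CommutativeRing)
open import Data.Nat using (ℕ; _≤_)
open import Data.Product using (Σ; _×_; _,_; proj₁; proj₂)
open import Relation.Nullary using (¬_; yes; no)

open import Data.Nat as ℕ using (zero; suc; _∸_; _<_; s≤s)
import Data.Nat.Properties as ℕ
import Relation.Binary.PropositionalEquality as ≡

-- Put a = vF and b = -(u + vF). The quadratic equation says exactly that Fb = w, so
-- a + b = -u and ab = vw. Waring's formula
--   a^k + b^k = Σ_i (-1)^i W(k,i) (a+b)^(k-2i) (ab)^i,
-- whose coefficients satisfy the Lucas recursion W(k+2,i+1) = W(k+1,i+1) + W(k,i) and equal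
-- T(k,i) for k ≥ 1, turns the sum in the denominator into -(a^k + b^k). Since a^k = F^k v^k,
-- the denominator is -b^k. Now b has constant term -u(0), a unit, so b is invertible in
-- R[[x]], and E = -(b⁻¹)^k works: -w^k E = (Fb)^k (b⁻¹)^k = F^k.

module WaringCoefficients where
  open import Data.Nat
  open import Data.Nat.Properties
  open import Data.Nat.DivMod using (m*n/n≡m; /-congˡ; /-monoˡ-≤; m/n*n≤m)
  open import Data.Nat.Tactic.RingSolver using (solve-∀)
  open import Relation.Binary.PropositionalEquality
  open ≡-Reasoning

  -- Coefficients of Waring's formula, defined by the Lucas recursion; unlike T, waringCoeff 0 0 = 2.
  waringCoeff : ℕ → ℕ → ℕ
  waringCoeff zero          zero    = 2
  waringCoeff zero          (suc i) = 0
  waringCoeff (suc k)       zero    = 1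
  waringCoeff (suc zero)    (suc i) = 0
  waringCoeff (suc (suc k)) (suc i) = waringCoeff (suc k) (suc i) + waringCoeff k i

  waringCoeff-vanishes : ∀ {k i} → k < 2 * i → waringCoeff k i ≡ 0
  waringCoeff-vanishes {zero}        {suc i} _ = refl
  waringCoeff-vanishes {suc zero}    {suc i} _ = refl
  waringCoeff-vanishes {suc (suc k)} {suc i} 2+k<2+2i = cong₂ _+_
    (waringCoeff-vanishes {suc k} {suc i} (<-trans (n<1+n (suc k)) 2+k<2+2i))
    (waringCoeff-vanishes {k} {i} (+-cancelˡ-< 2 k (2 * i) (subst (2 + k <_) (*-suc 2 i) 2+k<2+2i)))

  waringCoeff-diagonal : ∀ i → waringCoeff (2 * i) i ≡ 2
  waringCoeff-diagonal zero = refl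
  waringCoeff-diagonal (suc i) rewrite *-suc 2 i = cong₂ _+_
    (waringCoeff-vanishes {suc (2 * i)} {suc i} (subst (suc (2 * i) <_) (sym (*-suc 2 i)) (n<1+n _)))
    (waringCoeff-diagonal i)

  waringCoeff-step : ∀ j i → waringCoeff (suc j + 2 * suc i) (suc i)
                           ≡ waringCoeff (j + 2 * suc i) (suc i) + waringCoeff (suc j + 2 * i) i
  waringCoeff-step j i = trans
    (cong (λ m → waringCoeff m (suc i)) (lhs-index j i))
    (cong (λ m → waringCoeff m (suc i) + waringCoeff (suc j + 2 * i) i) (sym (rhs-index j i)))
    where
    lhs-index : ∀ j i → suc j + 2 * suc i ≡ 2 + (suc j + 2 * i)
    lhs-index = solve-∀
    rhs-index : ∀ j i → j + 2 * suc i ≡ suc (suc j + 2 * i)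
    rhs-index = solve-∀

  waringCoeff-factorial : ∀ j i {n} → j + i ≡ suc n →
                          waringCoeff (j + 2 * i) i * (i ! * j !) ≡ n ! * (j + 2 * i)
  waringCoeff-factorial (suc j) zero refl rewrite +-identityʳ j = arith j (j !)
    where
    arith : ∀ j f → 1 * (1 * (suc j * f)) ≡ f * suc j
    arith = solve-∀
  waringCoeff-factorial zero (suc i) refl rewrite waringCoeff-diagonal (suc i) = arith i (i !)
    where
    arith : ∀ i f → 2 * (suc i * f * 1) ≡ f * (2 * suc i)
    arith = solve-∀
  waringCoeff-factorial (suc j) (suc i) refl = begin
    waringCoeff (suc j + 2 * suc i) (suc i) * (suc i ! * suc j !)
      ≡⟨ cong (_* (suc i ! * suc j !)) (waringCoeff-step j i) ⟩
    (A + B) * ((suc i * i !) * (suc j * j !))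
      ≡⟨ expand A B i j (i !) (j !) ⟩
    A * (suc i ! * j !) * suc j + B * (i ! * suc j !) * suc i
      ≡⟨ cong₂ (λ x y → x * suc j + y * suc i)
               (waringCoeff-factorial j (suc i) (+-suc j i))
               (waringCoeff-factorial (suc j) i refl) ⟩
    (j + i) ! * (j + 2 * suc i) * suc j + (j + i) ! * (suc j + 2 * i) * suc i
      ≡⟨ collect i j ((j + i) !) ⟩
    suc (j + i) ! * (suc j + 2 * suc i)
      ≡⟨ cong (λ m → m ! * (suc j + 2 * suc i)) (sym (+-suc j i)) ⟩
    (j + suc i) ! * (suc j + 2 * suc i) ∎
    where
    A B : ℕ
    A = waringCoeff (j + 2 * suc i) (suc i)
    B = waringCoeff (suc j + 2 * i) i
    expand : ∀ A B i j fi fj → (A + B) * ((suc i * fi) * (suc j * fj))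
                             ≡ A * ((suc i * fi) * fj) * suc j + B * (fi * (suc j * fj)) * suc i
    expand = solve-∀
    collect : ∀ i j f → f * (j + 2 * suc i) * suc j + f * (suc j + 2 * i) * suc i
                      ≡ suc (j + i) * f * (suc j + 2 * suc i)
    collect = solve-∀

  T≡waringCoeff : ∀ {k i} → 1 ≤ k → 2 * i ≤ k → T k i ≡ waringCoeff k i
  T≡waringCoeff {k} {i} 1≤k 2i≤k =
    subst (λ k → 1 ≤ k → T k i ≡ waringCoeff k i) (m∸n+n≡m 2i≤k) (cases (k ∸ 2 * i) i) 1≤k
    where
    fromFactorial : ∀ j i {n} → j + i ≡ suc n → T (j + 2 * i) i ≡ waringCoeff (j + 2 * i) i
    fromFactorial j i {n} j+i≡1+n =
      trans (/-congˡ {{nz}} numerator) (m*n/n≡m (waringCoeff (j + 2 * i) i) _ {{nz}})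
      where
      nz : NonZero (i ! * (j + 2 * i ∸ 2 * i) !)
      nz = i !* (j + 2 * i ∸ 2 * i) !≢0
      j+2i∸i∸1≡n : j + 2 * i ∸ i ∸ 1 ≡ n
      j+2i∸i∸1≡n = begin
        j + 2 * i ∸ i ∸ 1   ≡⟨ cong (λ m → m ∸ i ∸ 1) (regroup j i) ⟩
        j + i + i ∸ i ∸ 1   ≡⟨ cong (_∸ 1) (m+n∸n≡m (j + i) i) ⟩
        j + i ∸ 1           ≡⟨ cong (_∸ 1) j+i≡1+n ⟩
        n                   ∎
        where
        regroup : ∀ j i → j + 2 * i ≡ j + i + i
        regroup = solve-∀
      numerator : (j + 2 * i ∸ i ∸ 1) ! * (j + 2 * i)
                ≡ waringCoeff (j + 2 * i) i * (i ! * (j + 2 * i ∸ 2 * i) !)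
      numerator rewrite j+2i∸i∸1≡n | m+n∸n≡m j (2 * i) = sym (waringCoeff-factorial j i j+i≡1+n)
    cases : ∀ j i → 1 ≤ j + 2 * i → T (j + 2 * i) i ≡ waringCoeff (j + 2 * i) i
    cases (suc j) i       _ = fromFactorial (suc j) i refl
    cases zero    (suc i) _ = fromFactorial zero (suc i) refl

  i≤k/2⇒2i≤k : ∀ {k i} → i ≤ k / 2 → 2 * i ≤ k
  i≤k/2⇒2i≤k {k} {i} i≤k/2 = ≤-trans (subst (2 * i ≤_) (*-comm 2 (k / 2)) (*-monoʳ-≤ 2 i≤k/2)) (m/n*n≤m k 2)

  k/2<i⇒k<2i : ∀ {k i} → k / 2 < i → k < 2 * i
  k/2<i⇒k<2i {k} {i} k/2<i = ≰⇒> λ 2i≤k →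
    <⇒≱ k/2<i (subst (_≤ k / 2) (m*n/n≡m i 2) (/-monoˡ-≤ 2 (subst (_≤ k) (*-comm 2 i) 2i≤k)))

module SumTo {c ℓ} (R : CommutativeRing c ℓ) where
  open CommutativeRing R
  open PowerSeries R using (sumTo)
  open import Algebra.Properties.Ring ring using (-‿+-comm)
  open import Algebra.Properties.CommutativeSemigroup +-commutativeSemigroup using (interchange)
  open import Relation.Binary.Reasoning.Setoid setoid

  sumTo-cong : ∀ n {g h} → (∀ i → i ≤ n → g i ≈ h i) → sumTo n g ≈ sumTo n h
  sumTo-cong zero    g≈h = g≈h 0 ℕ.z≤n
  sumTo-cong (suc n) g≈h = +-cong (sumTo-cong n (λ i i≤n → g≈h i (ℕ.m≤n⇒m≤1+n i≤n))) (g≈h (suc n) ℕ.≤-refl)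

  sumTo-+ : ∀ n g h → sumTo n (λ i → g i + h i) ≈ sumTo n g + sumTo n h
  sumTo-+ zero    g h = refl
  sumTo-+ (suc n) g h = trans (+-congʳ (sumTo-+ n g h)) (interchange _ _ _ _)

  sumTo-*ˡ : ∀ n x g → x * sumTo n g ≈ sumTo n (λ i → x * g i)
  sumTo-*ˡ zero    x g = refl
  sumTo-*ˡ (suc n) x g = trans (distribˡ x _ _) (+-congʳ (sumTo-*ˡ n x g))

  sumTo-neg : ∀ n g → - sumTo n g ≈ sumTo n (λ i → - g i)
  sumTo-neg zero    g = refl
  sumTo-neg (suc n) g = trans (sym (-‿+-comm _ _)) (+-congʳ (sumTo-neg n g))

  sumTo-shift : ∀ n g → sumTo (suc n) g ≈ g 0 + sumTo n (λ i → g (suc i))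
  sumTo-shift zero    g = refl
  sumTo-shift (suc n) g = trans (+-congʳ (sumTo-shift n g)) (+-assoc _ _ _)

  sumTo-reverse : ∀ n g → sumTo n g ≈ sumTo n (λ i → g (n ∸ i))
  sumTo-reverse zero    g = refl
  sumTo-reverse (suc n) g = begin
    sumTo n g + g (suc n)                       ≈⟨ +-congʳ (sumTo-reverse n g) ⟩
    sumTo n (λ i → g (n ∸ i)) + g (suc n)       ≈⟨ +-comm _ _ ⟩
    g (suc n) + sumTo n (λ i → g (n ∸ i))       ≈⟨ sumTo-shift n (λ i → g (suc n ∸ i)) ⟨
    sumTo (suc n) (λ i → g (suc n ∸ i))         ∎

  sumTo-truncate : ∀ {m n} g → m ≤ n → (∀ i → m < i → g i ≈ 0#) → sumTo n g ≈ sumTo m g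
  sumTo-truncate {m} {n} g m≤n vanish =
    ≡.subst (λ n → sumTo n g ≈ sumTo m g) (ℕ.m∸n+n≡m m≤n) (dropTail (n ∸ m))
    where
    dropTail : ∀ d → sumTo (d ℕ.+ m) g ≈ sumTo m g
    dropTail zero    = refl
    dropTail (suc d) = trans (+-cong (dropTail d) (vanish _ (s≤s (ℕ.m≤n+m m d)))) (+-identityʳ _)

module PowerSeriesRing {c ℓ} (R : CommutativeRing c ℓ) where
  open CommutativeRing R
  open PowerSeries R
  open SumTo R
  open import Algebra.Properties.Ring ring using (-‿distribʳ-*)
  import Algebra.Construct.Pointwise ℕ as Pointwise
  open import Relation.Binary.Reasoning.Setoid setoid

  shift : Series → Series
  shift f n = f (suc n)

  *ₛ-congʳ-≤ : ∀ f {g g'} n → (∀ m → m ≤ n → g m ≈ g' m) → (f *ₛ g) n ≈ (f *ₛ g') n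
  *ₛ-congʳ-≤ f n g≈g' = sumTo-cong n (λ j _ → *-congˡ (g≈g' (n ∸ j) (ℕ.m∸n≤m n j)))

  *ₛ-cong : ∀ {f f' g g'} → f ≈ₛ f' → g ≈ₛ g' → (f *ₛ g) ≈ₛ (f' *ₛ g')
  *ₛ-cong f≈f' g≈g' n = sumTo-cong n (λ j _ → *-cong (f≈f' j) (g≈g' (n ∸ j)))

  *ₛ-comm : ∀ f g → (f *ₛ g) ≈ₛ (g *ₛ f)
  *ₛ-comm f g n = begin
    sumTo n (λ j → f j * g (n ∸ j))               ≈⟨ sumTo-reverse n _ ⟩
    sumTo n (λ j → f (n ∸ j) * g (n ∸ (n ∸ j)))   ≈⟨ sumTo-cong n swap ⟩
    sumTo n (λ j → g j * f (n ∸ j))               ∎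
    where
    swap : ∀ j → j ≤ n → f (n ∸ j) * g (n ∸ (n ∸ j)) ≈ g j * f (n ∸ j)
    swap j j≤n = trans (*-comm _ _) (*-congʳ (reflexive (≡.cong g (ℕ.m∸[m∸n]≡n j≤n))))

  *ₛ-distribʳ : ∀ h f g → ((f +ₛ g) *ₛ h) ≈ₛ ((f *ₛ h) +ₛ (g *ₛ h))
  *ₛ-distribʳ h f g n = trans (sumTo-cong n (λ j _ → distribʳ _ _ _)) (sumTo-+ n _ _)

  *ₛ-suc : ∀ f g n → (f *ₛ g) (suc n) ≈ f 0 * g (suc n) + (shift f *ₛ g) n
  *ₛ-suc f g n = sumTo-shift n _

  *ₛ-identityˡ : ∀ f → (1ₛ *ₛ f) ≈ₛ f
  *ₛ-identityˡ f zero    = *-identityˡ _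
  *ₛ-identityˡ f (suc n) = begin
    (1ₛ *ₛ f) (suc n)                           ≈⟨ *ₛ-suc 1ₛ f n ⟩
    1# * f (suc n) + sumTo n (λ j → 0# * f (n ∸ j))
      ≈⟨ +-cong (*-identityˡ _) (sumTo-truncate {n = n} (λ j → 0# * f (n ∸ j)) ℕ.z≤n (λ _ _ → zeroˡ _)) ⟩
    f (suc n) + 0# * f n                        ≈⟨ +-congˡ (zeroˡ _) ⟩
    f (suc n) + 0#                              ≈⟨ +-identityʳ _ ⟩
    f (suc n)                                   ∎

  *ₛ-identityʳ : ∀ f → (f *ₛ 1ₛ) ≈ₛ f
  *ₛ-identityʳ f n = trans (*ₛ-comm f 1ₛ n) (*ₛ-identityˡ f n)

  *ₛ-distribˡ : ∀ h f g → (h *ₛ (f +ₛ g)) ≈ₛ ((h *ₛ f) +ₛ (h *ₛ g))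
  *ₛ-distribˡ h f g n =
    trans (*ₛ-comm h _ n) (trans (*ₛ-distribʳ h f g n) (+-cong (*ₛ-comm f h n) (*ₛ-comm g h n)))

  *ₛ-scaleˡ : ∀ x f g n → ((λ m → x * f m) *ₛ g) n ≈ x * (f *ₛ g) n
  *ₛ-scaleˡ x f g n = trans (sumTo-cong n (λ j _ → *-assoc _ _ _)) (sym (sumTo-*ˡ n x _))

  *ₛ-assoc : ∀ f g h → ((f *ₛ g) *ₛ h) ≈ₛ (f *ₛ (g *ₛ h))
  *ₛ-assoc f g h zero    = *-assoc _ _ _
  *ₛ-assoc f g h (suc n) = begin
    ((f *ₛ g) *ₛ h) (suc n)
      ≈⟨ *ₛ-suc (f *ₛ g) h n ⟩
    (f 0 * g 0) * h (suc n) + (shift (f *ₛ g) *ₛ h) n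
      ≈⟨ +-congˡ (*ₛ-cong {g = h} (*ₛ-suc f g) (λ _ → refl) n) ⟩
    (f 0 * g 0) * h (suc n) + (((λ m → f 0 * shift g m) +ₛ (shift f *ₛ g)) *ₛ h) n
      ≈⟨ +-congˡ (*ₛ-distribʳ h _ _ n) ⟩
    (f 0 * g 0) * h (suc n) + (((λ m → f 0 * shift g m) *ₛ h) n + ((shift f *ₛ g) *ₛ h) n)
      ≈⟨ +-congˡ (+-cong (*ₛ-scaleˡ (f 0) (shift g) h n) (*ₛ-assoc (shift f) g h n)) ⟩
    (f 0 * g 0) * h (suc n) + (f 0 * (shift g *ₛ h) n + (shift f *ₛ (g *ₛ h)) n)
      ≈⟨ +-assoc _ _ _ ⟨
    ((f 0 * g 0) * h (suc n) + f 0 * (shift g *ₛ h) n) + (shift f *ₛ (g *ₛ h)) n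
      ≈⟨ +-congʳ (trans (+-congʳ (*-assoc _ _ _)) (sym (distribˡ _ _ _))) ⟩
    f 0 * (g 0 * h (suc n) + (shift g *ₛ h) n) + (shift f *ₛ (g *ₛ h)) n
      ≈⟨ +-congʳ (*-congˡ (*ₛ-suc g h n)) ⟨
    f 0 * (g *ₛ h) (suc n) + (shift f *ₛ (g *ₛ h)) n
      ≈⟨ *ₛ-suc f (g *ₛ h) n ⟨
    (f *ₛ (g *ₛ h)) (suc n) ∎

  seriesRing : CommutativeRing c ℓ
  seriesRing = record
    { Carrier = Series
    ; _≈_ = _≈ₛ_
    ; _+_ = _+ₛ_
    ; _*_ = _*ₛ_
    ; -_ = -ₛ_
    ; 0# = 0ₛ
    ; 1# = 1ₛ
    ; isCommutativeRing = record
      { isRing = record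
        { +-isAbelianGroup = Pointwise.isAbelianGroup +-isAbelianGroup
        ; *-cong = *ₛ-cong
        ; *-assoc = *ₛ-assoc
        ; *-identity = *ₛ-identityˡ , *ₛ-identityʳ
        ; distrib = *ₛ-distribˡ , *ₛ-distribʳ
        }
      ; *-comm = *ₛ-comm
      }
    }

  -- e₀ = b₀⁻¹ and e_{n+1} = - b₀⁻¹ Σ_{j ≤ n} b_{j+1} e_{n-j}. This recursion is not structural,
  -- so the coefficients are computed with fuel; the fuel-0 clause is never reached when fuel > n.
  module Inverse (b : Series) {b₀⁻¹ : Carrier} (b₀⁻¹*b₀≈1 : b₀⁻¹ * b 0 ≈ 1#) where

    inverseCoeff : ℕ → ℕ → Carrier
    inverseCoeff _          zero    = b₀⁻¹
    inverseCoeff zero       (suc n) = 0#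
    inverseCoeff (suc fuel) (suc n) = - (b₀⁻¹ * (shift b *ₛ inverseCoeff fuel) n)

    inverseCoeff-stable : ∀ {fuel fuel'} n → n < fuel → n < fuel' → inverseCoeff fuel n ≈ inverseCoeff fuel' n
    inverseCoeff-stable                   zero    _          _           = refl
    inverseCoeff-stable {suc f} {suc f'} (suc n) (s≤s n<f) (s≤s n<f') =
      -‿cong (*-congˡ (*ₛ-congʳ-≤ (shift b) n (λ m m≤n →
        inverseCoeff-stable m (ℕ.≤-<-trans m≤n n<f) (ℕ.≤-<-trans m≤n n<f'))))

    inverse : Series
    inverse n = inverseCoeff (suc n) n

    *ₛ-inverseʳ : (b *ₛ inverse) ≈ₛ 1ₛ
    *ₛ-inverseʳ zero    = trans (*-comm _ _) b₀⁻¹*b₀≈1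
    *ₛ-inverseʳ (suc n) = begin
      (b *ₛ inverse) (suc n)                  ≈⟨ *ₛ-suc b inverse n ⟩
      b 0 * inverse (suc n) + Y               ≈⟨ +-congʳ (*-congˡ (-‿cong (*-congˡ stable))) ⟩
      b 0 * - (b₀⁻¹ * Y) + Y                  ≈⟨ +-congʳ (-‿distribʳ-* _ _) ⟨
      - (b 0 * (b₀⁻¹ * Y)) + Y                ≈⟨ +-congʳ (-‿cong (*-assoc _ _ _)) ⟨
      - ((b 0 * b₀⁻¹) * Y) + Y                ≈⟨ +-congʳ (-‿cong (*-congʳ (trans (*-comm _ _) b₀⁻¹*b₀≈1))) ⟩
      - (1# * Y) + Y                          ≈⟨ +-congʳ (-‿cong (*-identityˡ Y)) ⟩
      - Y + Y                                 ≈⟨ -‿inverseˡ Y ⟩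
      0#                                      ∎
      where
      Y : Carrier
      Y = (shift b *ₛ inverse) n
      stable : (shift b *ₛ inverseCoeff (suc n)) n ≈ Y
      stable = *ₛ-congʳ-≤ (shift b) n (λ m m≤n → inverseCoeff-stable m (s≤s m≤n) ℕ.≤-refl)

module RingIdentities {c ℓ} (R : CommutativeRing c ℓ) where
  open CommutativeRing R
  open PowerSeries R using (sumTo)
  open SumTo R
  open WaringCoefficients
  open import Algebra.Properties.Semiring.Mult semiring
    using (×-homo-+; ×-comm-*; ×-assoc-*; ×-congʳ) renaming (_×_ to _·_)
  open import Algebra.Properties.Semiring.Exp semiring using (_^_; ^-congˡ)
  open import Algebra.Properties.CommutativeSemiring.Exp commutativeSemiring using (^-distrib-*)
  open import Algebra.Properties.CommutativeSemigroup *-commutativeSemigroup using (x∙yz≈y∙xz)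
  open import Algebra.Properties.Ring ring
    using (-‿distribˡ-*; -‿distribʳ-*; -‿involutive; -‿+-comm; +-inverseʳ-unique; xyx⁻¹≈y)
  open import Data.Nat.DivMod using (m/n≤m)
  open import Relation.Binary.Reasoning.Setoid setoid

  -x*-y≈x*y : ∀ x y → - x * - y ≈ x * y
  -x*-y≈x*y x y = begin
    - x * - y       ≈⟨ -‿distribˡ-* x (- y) ⟨
    - (x * - y)     ≈⟨ -‿cong (-‿distribʳ-* x y) ⟨
    - - (x * y)     ≈⟨ -‿involutive _ ⟩
    x * y           ∎

  x+-[x+y]≈-y : ∀ x y → x + - (x + y) ≈ - y
  x+-[x+y]≈-y x y = begin
    x + - (x + y)     ≈⟨ +-congˡ (-‿+-comm x y) ⟨
    x + (- x + - y)   ≈⟨ +-assoc _ _ _ ⟨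
    (x + - x) + - y   ≈⟨ +-congʳ (-‿inverseʳ x) ⟩
    0# + - y          ≈⟨ +-identityˡ _ ⟩
    - y               ∎

  1^n≈1 : ∀ n → 1# ^ n ≈ 1#
  1^n≈1 zero    = refl
  1^n≈1 (suc n) = trans (*-identityˡ _) (1^n≈1 n)

  signed : ℕ → Carrier → Carrier
  signed zero    x = x
  signed (suc n) x = - signed n x

  signed-cong : ∀ n {x y} → x ≈ y → signed n x ≈ signed n y
  signed-cong zero    x≈y = x≈y
  signed-cong (suc n) x≈y = -‿cong (signed-cong n x≈y)

  signed-+ : ∀ m n x → signed (m ℕ.+ n) x ≡.≡ signed m (signed n x)
  signed-+ zero    n x = ≡.refl
  signed-+ (suc m) n x = ≡.cong -_ (signed-+ m n x)

  signed-neg : ∀ n x → signed n (- x) ≡.≡ - signed n x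
  signed-neg zero    x = ≡.refl
  signed-neg (suc n) x = ≡.cong -_ (signed-neg n x)

  signed-involutive : ∀ n x → signed n (signed n x) ≈ x
  signed-involutive zero    x = refl
  signed-involutive (suc n) x = begin
    - signed n (- signed n x)   ≡⟨ ≡.cong -_ (signed-neg n _) ⟩
    - - signed n (signed n x)   ≈⟨ -‿involutive _ ⟩
    signed n (signed n x)       ≈⟨ signed-involutive n x ⟩
    x                           ∎

  signed-*ˡ : ∀ n x y → signed n x * y ≈ signed n (x * y)
  signed-*ˡ zero    x y = refl
  signed-*ˡ (suc n) x y = trans (sym (-‿distribˡ-* _ _)) (-‿cong (signed-*ˡ n x y))

  signed-*ʳ : ∀ n x y → x * signed n y ≈ signed n (x * y)
  signed-*ʳ zero    x y = refl
  signed-*ʳ (suc n) x y = trans (sym (-‿distribʳ-* _ _)) (-‿cong (signed-*ʳ n x y))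

  ·-signed : ∀ m n x → m · signed n x ≈ signed n (m · x)
  ·-signed m n x = begin
    m · signed n x            ≈⟨ ×-congʳ m (*-identityˡ _) ⟨
    m · (1# * signed n x)     ≈⟨ ×-assoc-* m 1# _ ⟨
    (m · 1#) * signed n x     ≈⟨ signed-*ʳ n _ x ⟩
    signed n ((m · 1#) * x)   ≈⟨ signed-cong n (trans (×-assoc-* m 1# x) (×-congʳ m (*-identityˡ x))) ⟩
    signed n (m · x)          ∎

  ^-neg : ∀ n x → (- x) ^ n ≈ signed n (x ^ n)
  ^-neg zero    x = refl
  ^-neg (suc n) x = begin
    - x * (- x) ^ n            ≈⟨ *-congˡ (^-neg n x) ⟩
    - x * signed n (x ^ n)     ≈⟨ -‿distribˡ-* _ _ ⟨
    - (x * signed n (x ^ n))   ≈⟨ -‿cong (signed-*ʳ n x _) ⟩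
    - signed n (x * x ^ n)     ∎

  waringTerm : Carrier → Carrier → ℕ → ℕ → Carrier
  waringTerm s p k i = waringCoeff k i · (s ^ (k ∸ 2 ℕ.* i) * p ^ i)

  waringTerm-cong : ∀ {s s' p p'} → s ≈ s' → p ≈ p' → ∀ k i → waringTerm s p k i ≈ waringTerm s' p' k i
  waringTerm-cong s≈s' p≈p' k i = ×-congʳ (waringCoeff k i) (*-cong (^-congˡ (k ∸ 2 ℕ.* i) s≈s') (^-congˡ i p≈p'))

  waringTerm-vanishes : ∀ s p {k i} → k < 2 ℕ.* i → waringTerm s p k i ≈ 0#
  waringTerm-vanishes s p {k} {i} k<2i =
    reflexive (≡.cong (_· (s ^ (k ∸ 2 ℕ.* i) * p ^ i)) (waringCoeff-vanishes k<2i))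

  module _ (s p : Carrier) where

    waringTerm-zero : ∀ k → waringTerm s p (2 ℕ.+ k) 0 ≈ s * waringTerm s p (suc k) 0
    waringTerm-zero k = trans (×-congʳ 1 (*-assoc s _ 1#)) (sym (×-comm-* 1 s _))

    waringTerm-suc : ∀ k i → waringTerm s p (2 ℕ.+ k) (suc i)
                           ≈ s * waringTerm s p (suc k) (suc i) + p * waringTerm s p k i
    waringTerm-suc k i = begin
      (A ℕ.+ B) · (s ^ (2 ℕ.+ k ∸ 2 ℕ.* suc i) * p ^ suc i)
        ≡⟨ ≡.cong (λ e → (A ℕ.+ B) · (s ^ (2 ℕ.+ k ∸ e) * p ^ suc i)) (ℕ.*-suc 2 i) ⟩
      (A ℕ.+ B) · X                                     ≈⟨ ×-homo-+ X A B ⟩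
      A · X + B · X                                     ≈⟨ +-cong (trans lower (sym (×-comm-* A s _))) higher ⟩
      s * (A · Y) + p * waringTerm s p k i              ∎
      where
      A B : ℕ
      A = waringCoeff (suc k) (suc i)
      B = waringCoeff k i
      X Y : Carrier
      X = s ^ (k ∸ 2 ℕ.* i) * p ^ suc i
      Y = s ^ (suc k ∸ 2 ℕ.* suc i) * p ^ suc i
      lower : A · X ≈ A · (s * Y)
      lower with 2 ℕ.* suc i ℕ.≤? suc k
      ... | yes 2i+2≤k+1 = ×-congʳ A (trans (*-congʳ (reflexive (≡.cong (s ^_) exponent))) (*-assoc s _ _))
        where
        exponent : k ∸ 2 ℕ.* i ≡.≡ suc (suc k ∸ 2 ℕ.* suc i)
        exponent = ≡.trans (≡.cong (suc (suc k) ∸_) (≡.sym (ℕ.*-suc 2 i))) (ℕ.+-∸-assoc 1 2i+2≤k+1)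
      ... | no 2i+2≰k+1 = ≡.subst (λ a → a · X ≈ a · (s * Y)) (≡.sym A≡0) refl
        where
        A≡0 : A ≡.≡ 0
        A≡0 = waringCoeff-vanishes {suc k} {suc i} (ℕ.≰⇒> 2i+2≰k+1)
      higher : B · X ≈ p * waringTerm s p k i
      higher = trans (×-congʳ B (x∙yz≈y∙xz _ p _)) (sym (×-comm-* B p _))

    waringSum-suc : ∀ k → sumTo (2 ℕ.+ k) (waringTerm s p (2 ℕ.+ k))
                        ≈ s * sumTo (2 ℕ.+ k) (waringTerm s p (suc k)) + p * sumTo (suc k) (waringTerm s p k)
    waringSum-suc k = begin
      sumTo (2 ℕ.+ k) t₂
        ≈⟨ sumTo-shift (suc k) t₂ ⟩
      t₂ 0 + sumTo (suc k) (λ i → t₂ (suc i))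
        ≈⟨ +-cong (waringTerm-zero k) (sumTo-cong (suc k) (λ i _ → waringTerm-suc k i)) ⟩
      s * t₁ 0 + sumTo (suc k) (λ i → s * t₁ (suc i) + p * t₀ i)
        ≈⟨ +-congˡ (sumTo-+ (suc k) _ _) ⟩
      s * t₁ 0 + (sumTo (suc k) (λ i → s * t₁ (suc i)) + sumTo (suc k) (λ i → p * t₀ i))
        ≈⟨ +-congˡ (+-cong (sumTo-*ˡ (suc k) s _) (sumTo-*ˡ (suc k) p _)) ⟨
      s * t₁ 0 + (s * sumTo (suc k) (λ i → t₁ (suc i)) + p * sumTo (suc k) t₀)
        ≈⟨ +-assoc _ _ _ ⟨
      (s * t₁ 0 + s * sumTo (suc k) (λ i → t₁ (suc i))) + p * sumTo (suc k) t₀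
        ≈⟨ +-congʳ (distribˡ s _ _) ⟨
      s * (t₁ 0 + sumTo (suc k) (λ i → t₁ (suc i))) + p * sumTo (suc k) t₀
        ≈⟨ +-congʳ (*-congˡ (sumTo-shift (suc k) t₁)) ⟨
      s * sumTo (2 ℕ.+ k) t₁ + p * sumTo (suc k) t₀
        ∎
      where
      t₂ t₁ t₀ : ℕ → Carrier
      t₂ = waringTerm s p (2 ℕ.+ k)
      t₁ = waringTerm s p (suc k)
      t₀ = waringTerm s p k

  powerSum-suc : ∀ a b k → a ^ (2 ℕ.+ k) + b ^ (2 ℕ.+ k)
                         ≈ (a + b) * (a ^ suc k + b ^ suc k) + - (a * b) * (a ^ k + b ^ k)
  powerSum-suc a b k = sym (begin
    (a + b) * (a * A + b * B) + - (a * b) * (A + B)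
      ≈⟨ +-cong (expand a b A B) (-‿distribˡ-* _ _) ⟨
    ((a * b) * (A + B) + (a * (a * A) + b * (b * B))) + - ((a * b) * (A + B))
      ≈⟨ xyx⁻¹≈y _ _ ⟩
    a * (a * A) + b * (b * B) ∎)
    where
    A B : Carrier
    A = a ^ k
    B = b ^ k
    open import Algebra.Solver.Ring.NaturalCoefficients.Default commutativeSemiring
    expand : ∀ a b A B → (a * b) * (A + B) + (a * (a * A) + b * (b * B)) ≈ (a + b) * (a * A + b * B)
    expand = solve 4 (λ a b A B → (a :* b) :* (A :+ B) :+ (a :* (a :* A) :+ b :* (b :* B))
                                  := (a :+ b) :* (a :* A :+ b :* B)) refl

  -- Waring's formula, with the sign (-1)^i absorbed into p = -ab.
  waring : ∀ a b k → a ^ k + b ^ k ≈ sumTo k (waringTerm (a + b) (- (a * b)) k)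
  waring a b zero = +-cong (sym (*-identityˡ 1#)) (sym (trans (+-identityʳ _) (*-identityˡ 1#)))
  waring a b (suc zero) = begin
    a * 1# + b * 1#                  ≈⟨ distribʳ 1# a b ⟨
    (a + b) * 1#                     ≈⟨ *-identityʳ _ ⟨
    ((a + b) * 1#) * 1#              ≈⟨ +-identityʳ _ ⟨
    ((a + b) * 1#) * 1# + 0#         ≈⟨ +-identityʳ _ ⟨
    (((a + b) * 1#) * 1# + 0#) + 0#  ∎
  waring a b (suc (suc k)) = begin
    a ^ (2 ℕ.+ k) + b ^ (2 ℕ.+ k)
      ≈⟨ powerSum-suc a b k ⟩
    s * (a ^ suc k + b ^ suc k) + p * (a ^ k + b ^ k)
      ≈⟨ +-cong (*-congˡ (waring a b (suc k))) (*-congˡ (waring a b k)) ⟩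
    s * sumTo (suc k) (waringTerm s p (suc k)) + p * sumTo k (waringTerm s p k)
      ≈⟨ +-cong (*-congˡ (dropLast (suc k))) (*-congˡ (dropLast k)) ⟨
    s * sumTo (2 ℕ.+ k) (waringTerm s p (suc k)) + p * sumTo (suc k) (waringTerm s p k)
      ≈⟨ waringSum-suc s p k ⟨
    sumTo (2 ℕ.+ k) (waringTerm s p (2 ℕ.+ k)) ∎
    where
    s p : Carrier
    s = a + b
    p = - (a * b)
    dropLast : ∀ n → sumTo (suc n) (waringTerm s p n) ≈ sumTo n (waringTerm s p n)
    dropLast n = sumTo-truncate _ (ℕ.n≤1+n n)
      (λ i n<i → waringTerm-vanishes s p (ℕ.<-≤-trans n<i (ℕ.m≤m+n i _)))

  denominatorTerm : (u v w : Carrier) → ℕ → ℕ → Carrier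
  denominatorTerm u v w k i = signed (k ℕ.+ i ℕ.+ 1) (T k i · ((u ^ (k ∸ 2 ℕ.* i) * v ^ i) * w ^ i))

  denominator : (F w u v : Carrier) → ℕ → Carrier
  denominator F w u v k = F ^ k * v ^ k + sumTo (k ℕ./ 2) (denominatorTerm u v w k)

  denominatorTerm≈-waringTerm : ∀ u v w {k i} → 1 ≤ k → 2 ℕ.* i ≤ k →
                     denominatorTerm u v w k i ≈ - waringTerm (- u) (- (v * w)) k i
  denominatorTerm≈-waringTerm u v w {k} {i} 1≤k 2i≤k = begin
    signed (k ℕ.+ i ℕ.+ 1) (T k i · Z′)
      ≡⟨ ≡.cong (λ n → signed n (T k i · Z′)) parity ⟩
    - signed ((i ℕ.+ i) ℕ.+ (m ℕ.+ i)) (T k i · Z′)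
      ≡⟨ ≡.cong -_ (≡.trans (signed-+ (i ℕ.+ i) (m ℕ.+ i) _) (signed-+ i i _)) ⟩
    - signed i (signed i (signed (m ℕ.+ i) (T k i · Z′)))
      ≈⟨ -‿cong (signed-involutive i _) ⟩
    - signed (m ℕ.+ i) (T k i · Z′)
      ≡⟨ ≡.cong -_ (signed-+ m i _) ⟩
    - signed m (signed i (T k i · Z′))
      ≈⟨ -‿cong (signed-cong m (signed-cong i coefficient)) ⟩
    - signed m (signed i (W · Z))
      ≈⟨ -‿cong (trans (·-signed W m _) (signed-cong m (·-signed W i Z))) ⟨
    - (W · signed m (signed i Z))
      ≈⟨ -‿cong (×-congʳ W signs) ⟨
    - (W · ((- u) ^ m * (- (v * w)) ^ i))
      ∎
    where
    m W : ℕ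
    m = k ∸ 2 ℕ.* i
    W = waringCoeff k i
    Z′ Z : Carrier
    Z′ = (u ^ m * v ^ i) * w ^ i
    Z = u ^ m * (v * w) ^ i
    parity : k ℕ.+ i ℕ.+ 1 ≡.≡ suc ((i ℕ.+ i) ℕ.+ (m ℕ.+ i))
    parity = ≡.subst (λ n → n ℕ.+ i ℕ.+ 1 ≡.≡ suc ((i ℕ.+ i) ℕ.+ (m ℕ.+ i))) (ℕ.m∸n+n≡m 2i≤k) (rearrange m i)
      where
      open import Data.Nat.Tactic.RingSolver using (solve-∀)
      rearrange : ∀ m i → m ℕ.+ 2 ℕ.* i ℕ.+ i ℕ.+ 1 ≡.≡ suc ((i ℕ.+ i) ℕ.+ (m ℕ.+ i))
      rearrange = solve-∀
    coefficient : T k i · Z′ ≈ W · Z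
    coefficient = trans (reflexive (≡.cong (_· Z′) (T≡waringCoeff 1≤k 2i≤k)))
                        (×-congʳ W (trans (*-assoc _ _ _) (*-congˡ (sym (^-distrib-* v w i)))))
    signs : (- u) ^ m * (- (v * w)) ^ i ≈ signed m (signed i Z)
    signs = begin
      (- u) ^ m * (- (v * w)) ^ i               ≈⟨ *-cong (^-neg m u) (^-neg i (v * w)) ⟩
      signed m (u ^ m) * signed i ((v * w) ^ i)  ≈⟨ signed-*ˡ m _ _ ⟩
      signed m (u ^ m * signed i ((v * w) ^ i))  ≈⟨ signed-cong m (signed-*ʳ i _ _) ⟩
      signed m (signed i Z)                      ∎

  denominatorSum≈-powerSum : ∀ {a b u v w} → a + b ≈ - u → a * b ≈ v * w → ∀ {k} → 1 ≤ k →
                    sumTo (k ℕ./ 2) (denominatorTerm u v w k) ≈ - (a ^ k + b ^ k)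
  denominatorSum≈-powerSum {a} {b} {u} {v} {w} a+b≈-u ab≈vw {k} 1≤k = begin
    sumTo (k ℕ./ 2) (denominatorTerm u v w k)
      ≈⟨ sumTo-cong (k ℕ./ 2) (λ i i≤k/2 → denominatorTerm≈-waringTerm u v w 1≤k (i≤k/2⇒2i≤k i≤k/2)) ⟩
    sumTo (k ℕ./ 2) (λ i → - waringTerm (- u) (- (v * w)) k i)
      ≈⟨ sumTo-neg (k ℕ./ 2) _ ⟨
    - sumTo (k ℕ./ 2) (waringTerm (- u) (- (v * w)) k)
      ≈⟨ -‿cong (sumTo-cong (k ℕ./ 2) (λ i _ → waringTerm-cong (sym a+b≈-u) (-‿cong (sym ab≈vw)) k i)) ⟩
    - sumTo (k ℕ./ 2) (waringTerm (a + b) (- (a * b)) k)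
      ≈⟨ -‿cong (sumTo-truncate _ (m/n≤m k 2) (λ i k/2<i → waringTerm-vanishes (a + b) (- (a * b)) (k/2<i⇒k<2i {k} {i} k/2<i))) ⟨
    - sumTo k (waringTerm (a + b) (- (a * b)) k)
      ≈⟨ -‿cong (waring a b k) ⟨
    - (a ^ k + b ^ k)
      ∎

  quadratic⇒F*-[u+vF]≈w : ∀ {F w u v} → (w + u * F) + v * F ^ 2 ≈ 0# → F * - (u + v * F) ≈ w
  quadratic⇒F*-[u+vF]≈w {F} {w} {u} {v} quadratic = begin
    F * - (u + v * F)         ≈⟨ -‿distribʳ-* _ _ ⟨
    - (F * (u + v * F))       ≈⟨ -‿cong (expand F u v) ⟩
    - (u * F + v * F ^ 2)     ≈⟨ -‿cong (+-inverseʳ-unique w _ (trans (sym (+-assoc _ _ _)) quadratic)) ⟩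
    - - w                     ≈⟨ -‿involutive w ⟩
    w                         ∎
    where
    open import Algebra.Solver.Ring.NaturalCoefficients.Default commutativeSemiring
    expand : ∀ F u v → F * (u + v * F) ≈ u * F + v * (F * (F * 1#))
    expand = solve 3 (λ F u v → F :* (u :+ v :* F) := u :* F :+ v :* (F :* (F :* con 1))) refl

  -- With a = vF and b = -(u + vF): a + b = -u and ab = vw, while a^k = F^k v^k.
  denominator-closedForm : ∀ {F w u v} → (w + u * F) + v * F ^ 2 ≈ 0# → ∀ {k} → 1 ≤ k →
                 denominator F w u v k ≈ - ((- (u + v * F)) ^ k)
  denominator-closedForm {F} {w} {u} {v} quadratic {k} 1≤k = begin
    F ^ k * v ^ k + sumTo (k ℕ./ 2) (denominatorTerm u v w k)
      ≈⟨ +-cong (trans (*-comm _ _) (sym (^-distrib-* v F k))) (denominatorSum≈-powerSum a+b≈-u ab≈vw 1≤k) ⟩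
    (v * F) ^ k + - ((v * F) ^ k + (- (u + v * F)) ^ k)
      ≈⟨ x+-[x+y]≈-y _ _ ⟩
    - ((- (u + v * F)) ^ k)
      ∎
    where
    a+b≈-u : v * F + - (u + v * F) ≈ - u
    a+b≈-u = trans (+-congˡ (-‿cong (+-comm u (v * F)))) (x+-[x+y]≈-y _ _)
    ab≈vw : (v * F) * - (u + v * F) ≈ v * w
    ab≈vw = trans (*-assoc _ _ _) (*-congˡ (quadratic⇒F*-[u+vF]≈w quadratic))

  ^-preserves-inverse : ∀ {b e} → b * e ≈ 1# → ∀ k → b ^ k * e ^ k ≈ 1#
  ^-preserves-inverse {b} {e} be≈1 k = trans (sym (^-distrib-* b e k)) (trans (^-congˡ k be≈1) (1^n≈1 k))

  rootPower-formula : ∀ {F w u v e} → (w + u * F) + v * F ^ 2 ≈ 0# → - (u + v * F) * e ≈ 1# →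
                       ∀ {k} → 1 ≤ k →
                       denominator F w u v k * - (e ^ k) ≈ 1# × F ^ k ≈ - (w ^ k) * - (e ^ k)
  rootPower-formula {F} {w} {u} {v} {e} quadratic be≈1 {k} 1≤k = denominator*E≈1 , F^k≈-w^k*E
    where
    b : Carrier
    b = - (u + v * F)
    denominator*E≈1 : denominator F w u v k * - (e ^ k) ≈ 1#
    denominator*E≈1 = begin
      denominator F w u v k * - (e ^ k)   ≈⟨ *-congʳ (denominator-closedForm quadratic 1≤k) ⟩
      - (b ^ k) * - (e ^ k)               ≈⟨ -x*-y≈x*y _ _ ⟩
      b ^ k * e ^ k                       ≈⟨ ^-preserves-inverse be≈1 k ⟩
      1#                                  ∎
    F^k≈-w^k*E : F ^ k ≈ - (w ^ k) * - (e ^ k)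
    F^k≈-w^k*E = begin
      F ^ k                       ≈⟨ *-identityʳ _ ⟨
      F ^ k * 1#                  ≈⟨ *-congˡ (^-preserves-inverse be≈1 k) ⟨
      F ^ k * (b ^ k * e ^ k)     ≈⟨ *-assoc _ _ _ ⟨
      (F ^ k * b ^ k) * e ^ k     ≈⟨ *-congʳ (^-distrib-* F b k) ⟨
      (F * b) ^ k * e ^ k         ≈⟨ *-congʳ (^-congˡ k (quadratic⇒F*-[u+vF]≈w quadratic)) ⟩
      w ^ k * e ^ k               ≈⟨ -x*-y≈x*y _ _ ⟨
      - (w ^ k) * - (e ^ k)       ∎

module SeriesOperations {c ℓ} (R : CommutativeRing c ℓ) where
  open PowerSeries R hiding (sumTo)
  open PowerSeriesRing R using (seriesRing)
  open CommutativeRing seriesRing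
  open PowerSeries seriesRing using (sumTo)
  open RingIdentities seriesRing using (signed; denominator)
  open SumTo seriesRing using (sumTo-cong)
  open import Algebra.Properties.Semiring.Mult semiring using () renaming (_×_ to _·_)
  open import Algebra.Properties.Semiring.Exp semiring using (_^_)

  ^ₛ≡^ : ∀ f k → f ^ₛ k ≡.≡ f ^ k
  ^ₛ≡^ f zero    = ≡.refl
  ^ₛ≡^ f (suc k) = ≡.cong (f *ₛ_) (^ₛ≡^ f k)

  ·ₛ≡· : ∀ m f → m ·ₛ f ≡.≡ m · f
  ·ₛ≡· zero    f = ≡.refl
  ·ₛ≡· (suc m) f = ≡.cong (f +ₛ_) (·ₛ≡· m f)

  signₛ≡signed : ∀ n f → signₛ n f ≡.≡ signed n f
  signₛ≡signed zero    f = ≡.refl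
  signₛ≡signed (suc n) f = ≡.cong -ₛ_ (signₛ≡signed n f)

  sumSeries≡sumTo : ∀ n g → sumSeries n g ≡.≡ sumTo n g
  sumSeries≡sumTo zero    g = ≡.refl
  sumSeries≡sumTo (suc n) g = ≡.cong (_+ₛ g (suc n)) (sumSeries≡sumTo n g)

  denom≈denominator : ∀ F w u v k → denom F w u v k ≈ denominator F w u v k
  denom≈denominator F w u v k = +-cong
    (reflexive (≡.cong₂ _*ₛ_ (^ₛ≡^ F k) (^ₛ≡^ v k)))
    (trans (reflexive (sumSeries≡sumTo (k ℕ./ 2) _)) (sumTo-cong (k ℕ./ 2) (λ i _ → reflexive (term i))))
    where
    term : ∀ i → signₛ (k ℕ.+ i ℕ.+ 1) (T k i ·ₛ (((u ^ₛ (k ∸ 2 ℕ.* i)) *ₛ (v ^ₛ i)) *ₛ (w ^ₛ i)))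
           ≡.≡ signed (k ℕ.+ i ℕ.+ 1) (T k i · ((u ^ (k ∸ 2 ℕ.* i) * v ^ i) * w ^ i))
    term i = ≡.trans (signₛ≡signed (k ℕ.+ i ℕ.+ 1) _) (≡.cong (signed (k ℕ.+ i ℕ.+ 1))
               (≡.trans (·ₛ≡· (T k i) _) (≡.cong (T k i ·_) (≡.cong₂ _*_
                 (≡.cong₂ _*_ (^ₛ≡^ u (k ∸ 2 ℕ.* i)) (^ₛ≡^ v i)) (^ₛ≡^ w i)))))

theorem2p2 : ∀ {c ℓ} (R : CommutativeRing c ℓ) → IsField R →
    let open CommutativeRing R
        open PowerSeries R
    in (F w u v : Series) →
       IsPolynomial w → IsPolynomial u → IsPolynomial v →
       v 0 ≈ 0# → ¬ (u 0 ≈ 0#) →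
       ((w +ₛ (u *ₛ F)) +ₛ (v *ₛ (F ^ₛ 2))) ≈ₛ 0ₛ →
       (k : ℕ) → 1 ≤ k →
       Σ Series (λ E → (denom F w u v k *ₛ E) ≈ₛ 1ₛ
                     × (F ^ₛ k) ≈ₛ ((-ₛ (w ^ₛ k)) *ₛ E))
theorem2p2 R (_ , invertible) F w u v _ _ _ v₀≈0 u₀≉0 quadratic k 1≤k =
  E ,
  trans (*-congʳ {E} (denom≈denominator F w u v k)) (proj₁ formula) ,
  ≡.subst₂ (λ x y → x ≈ - y * E) (≡.sym (^ₛ≡^ F k)) (≡.sym (^ₛ≡^ w k)) (proj₂ formula)
  where
  open PowerSeriesRing R using (seriesRing; module Inverse)
  open CommutativeRing seriesRing
  open RingIdentities seriesRing using (denominator; rootPower-formula)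
  open SeriesOperations R
  open import Algebra.Properties.Semiring.Exp semiring using (_^_)
  module R = CommutativeRing R
  open RingIdentities R using (-x*-y≈x*y)

  u₀⁻¹ : R.Carrier
  u₀⁻¹ = proj₁ (invertible (u 0) u₀≉0)

  b₀-invertible : (R.- u₀⁻¹) R.* (R.- (u 0 R.+ v 0 R.* F 0)) R.≈ R.1#
  b₀-invertible = R.trans (-x*-y≈x*y _ _) (R.trans (R.*-congˡ u₀+v₀F₀≈u₀)
                    (R.trans (R.*-comm _ _) (proj₂ (invertible (u 0) u₀≉0))))
    where
    u₀+v₀F₀≈u₀ : u 0 R.+ v 0 R.* F 0 R.≈ u 0
    u₀+v₀F₀≈u₀ = R.trans (R.+-congˡ (R.trans (R.*-congʳ v₀≈0) (R.zeroˡ _))) (R.+-identityʳ _)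

  open Inverse (- (u + v * F)) b₀-invertible renaming (inverse to e; *ₛ-inverseʳ to be≈1)

  E : Carrier
  E = - (e ^ k)

  formula : denominator F w u v k * E ≈ 1# × F ^ k ≈ - (w ^ k) * E
  formula = rootPower-formula quadratic be≈1 1≤k
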